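{- Let $\Sigma$ be a set and $c,d,R,S$ relations on $\Sigma$. Then the forward simulation $\forall\sigma,\sigma',\tau.\ \sigma R\sigma'\wedge\sigma\,c\,\tau\Rightarrow\exists\tau'.\ \sigma'\,d\,\tau'\wedge\tau S\tau'$ holds if and only if \[ \dot R;\langle c\mid\mathbf{hav}\rangle;\dot{id}\;\subseteq\;\Swarrow\big(\langle\dot R\,\|\,\dot{id}\rangle;\langle c\mid\mathbf{hav}\mid d\rangle;\langle\dot{id}\,\|\,\dot S\rangle\big), \] and the backward simulation $\forall\sigma,\tau,\tau'.\ \sigma\,c\,\tau\wedge\tau S\tau'\Rightarrow\exists\sigma'.\ \sigma R\sigma'\wedge\sigma'\,d\,\tau'$ holds if and only if \[ \dot{id};\langle c\mid\mathbf{hav}\rangle;\dot S\;\subseteq\;\Swarrow\big(\langle\dot{id}\,\|\,\dot R\rangle;\langle c\mid\mathbf{hav}\mid d\rangle;\langle\dot S\,\|\,\dot{id}\rangle\big). \]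
   Context: $\mathbf{hav}=\Sigma\times\Sigma$, $id=id_\Sigma$, and $;$ is relational composition. For relations $a,b$ on $\Sigma$, $\langle a\mid b\rangle$ is the relation on $\Sigma\times\Sigma$ with $(\sigma,\sigma')\langle a\mid b\rangle(\tau,\tau')$ iff $\sigma a\tau\wedge\sigma' b\tau'$. For a relation $R$ on $\Sigma$, $\dot R$ is the sub-identity on $\Sigma\times\Sigma$ relating $(\sigma,\sigma')$ to itself iff $\sigma R\sigma'$ (so $\dot{id}$ relates $(\sigma,\sigma)$ to itself). For relations $A,B$ on $\Sigma\times\Sigma$, $\langle A\,\|\,B\rangle$ is the relation on $\Sigma\times\Sigma\times\Sigma$ with $(\sigma,\sigma',\sigma'')\langle A\,\|\,B\rangle(\tau,\tau',\tau'')$ iff $(\sigma,\sigma')A(\tau,\tau')\wedge(\sigma',\sigma'')B(\tau',\tau'')$; and $\langle a\mid b\mid c\rangle:=\langle\langle a\mid b\rangle\,\|\,\langle b\mid c\rangle\rangle$, so $(\sigma,\sigma',\sigma'')\langle a\mid b\mid c\rangle(\tau,\tau',\tau'')$ iff $\sigma a\tau\wedge\sigma' b\tau'\wedge\sigma'' c\tau''$. For a relation $X$ on $\Sigma\times\Sigma\times\Sigma$, $\Swarrow X$ is the relation on $\Sigma\times\Sigma$ with $(\sigma,\sigma')\Swarrow X(\tau,\tau')$ iff $\exists\sigma'',\tau''.\ (\sigma,\sigma',\sigma'')X(\tau,\tau',\tau'')$. -}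

module Defs where

open import Data.Product using (Σ-syntax; ∃-syntax; _×_; _,_)
open import Data.Unit using (⊤)
open import Relation.Binary.PropositionalEquality using (_≡_)

Rel : Set → Set₁
Rel A = A → A → Set

_⨾_ : {A : Set} → Rel A → Rel A → Rel A
(a ⨾ b) x z = ∃[ y ] (a x y × b y z)
infixl 5 _⨾_

_⊆ᵣ_ : {A : Set} → Rel A → Rel A → Set
a ⊆ᵣ b = ∀ x y → a x y → b x y
infix 4 _⊆ᵣ_

idᵣ : {A : Set} → Rel A
idᵣ x y = x ≡ y

hav : {A : Set} → Rel A
hav _ _ = ⊤

⟨_∣_⟩ : {A : Set} → Rel A → Rel A → Rel (A × A)
⟨ a ∣ b ⟩ (σ , σ′) (τ , τ′) = a σ τ × b σ′ τ′

dot : {A : Set} → Rel A → Rel (A × A)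
dot R (σ , σ′) (τ , τ′) = (σ ≡ τ × σ′ ≡ τ′) × R σ σ′

⟨_∥_⟩ : {A : Set} → Rel (A × A) → Rel (A × A) → Rel (A × A × A)
⟨ P ∥ Q ⟩ (σ , σ′ , σ″) (τ , τ′ , τ″) = P (σ , σ′) (τ , τ′) × Q (σ′ , σ″) (τ′ , τ″)

⟨_∣_∣_⟩ : {A : Set} → Rel A → Rel A → Rel A → Rel (A × A × A)
⟨ a ∣ b ∣ c ⟩ = ⟨ ⟨ a ∣ b ⟩ ∥ ⟨ b ∣ c ⟩ ⟩

⇙ : {A : Set} → Rel (A × A × A) → Rel (A × A)
⇙ X (σ , σ′) (τ , τ′) = ∃[ σ″ ] ∃[ τ″ ] X (σ , σ′ , σ″) (τ , τ′ , τ″)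

ForwardSim : {A : Set} → Rel A → Rel A → Rel A → Rel A → Set
ForwardSim c d R S = ∀ σ σ′ τ → R σ σ′ → c σ τ → ∃[ τ′ ] (d σ′ τ′ × S τ τ′)

BackwardSim : {A : Set} → Rel A → Rel A → Rel A → Rel A → Set
BackwardSim c d R S = ∀ σ τ τ′ → c σ τ → S τ τ′ → ∃[ σ′ ] (R σ σ′ × d σ′ τ′)

{-# OPTIONS --safe #-}
module Submission where

open import Defs
open import Data.Product using (_×_; _,_; ∃-syntax)
open import Data.Unit using (tt)
open import Function.Bundles using (_⇔_; mk⇔; Equivalence)
open import Relation.Binary.PropositionalEquality using (_≡_; refl)

-- Every test (a dotted relation, or a ∥ of two) is a sub-identity, so both sides of each
-- inclusion evaluate pointwise to plain conjunctions; the inclusion then states the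
-- simulation condition verbatim, its existential witness being the third component hidden by ⇙.

module _ {Σ : Set} (c d R S : Rel Σ) where

  forwardLHS forwardRHS backwardLHS backwardRHS : Rel (Σ × Σ)
  forwardLHS = dot R ⨾ ⟨ c ∣ hav ⟩ ⨾ dot idᵣ
  forwardRHS = ⇙ (⟨ dot R ∥ dot idᵣ ⟩ ⨾ ⟨ c ∣ hav ∣ d ⟩ ⨾ ⟨ dot idᵣ ∥ dot S ⟩)
  backwardLHS = dot idᵣ ⨾ ⟨ c ∣ hav ⟩ ⨾ dot S
  backwardRHS = ⇙ (⟨ dot idᵣ ∥ dot R ⟩ ⨾ ⟨ c ∣ hav ∣ d ⟩ ⨾ ⟨ dot S ∥ dot idᵣ ⟩)

  forwardLHS-pointwise : ∀ {σ σ′ τ τ′} →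
    forwardLHS (σ , σ′) (τ , τ′) ⇔ (R σ σ′ × c σ τ × τ ≡ τ′)
  forwardLHS-pointwise = mk⇔
    (λ { (_ , (_ , ((refl , refl) , r) , (cστ , _)) , ((refl , refl) , refl)) → r , cστ , refl })
    (λ { (r , cστ , refl) → _ , (_ , ((refl , refl) , r) , (cστ , tt)) , ((refl , refl) , refl) })

  forwardRHS-pointwise : ∀ {σ σ′ τ τ′} →
    forwardRHS (σ , σ′) (τ , τ′) ⇔ (R σ σ′ × c σ τ × τ ≡ τ′ × ∃[ τ″ ] (d σ′ τ″ × S τ τ″))
  forwardRHS-pointwise = mk⇔
    (λ { (_ , τ″ , _ , (_ , (((refl , refl) , r) , ((refl , refl) , refl)) , ((cστ , _) , (_ , dσ′τ″)))
             , (((refl , refl) , refl) , ((refl , refl) , sττ″)))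
           → r , cστ , refl , τ″ , dσ′τ″ , sττ″ })
    (λ { (r , cστ , refl , τ″ , dσ′τ″ , sττ″)
           → _ , τ″ , _ , (_ , (((refl , refl) , r) , ((refl , refl) , refl)) , ((cστ , tt) , (tt , dσ′τ″)))
             , (((refl , refl) , refl) , ((refl , refl) , sττ″)) })

  backwardLHS-pointwise : ∀ {σ σ′ τ τ′} →
    backwardLHS (σ , σ′) (τ , τ′) ⇔ (σ ≡ σ′ × c σ τ × S τ τ′)
  backwardLHS-pointwise = mk⇔
    (λ { (_ , (_ , ((refl , refl) , refl) , (cστ , _)) , ((refl , refl) , sττ′)) → refl , cστ , sττ′ })
    (λ { (refl , cστ , sττ′) → _ , (_ , ((refl , refl) , refl) , (cστ , tt)) , ((refl , refl) , sττ′) })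

  backwardRHS-pointwise : ∀ {σ σ′ τ τ′} →
    backwardRHS (σ , σ′) (τ , τ′) ⇔ (σ ≡ σ′ × c σ τ × S τ τ′ × ∃[ σ″ ] (R σ′ σ″ × d σ″ τ′))
  backwardRHS-pointwise = mk⇔
    (λ { (σ″ , _ , _ , (_ , (((refl , refl) , refl) , ((refl , refl) , rσ′σ″)) , ((cστ , _) , (_ , dσ″τ′)))
             , (((refl , refl) , sττ′) , ((refl , refl) , refl)))
           → refl , cστ , sττ′ , σ″ , rσ′σ″ , dσ″τ′ })
    (λ { (refl , cστ , sττ′ , σ″ , rσ′σ″ , dσ″τ′)
           → σ″ , _ , _ , (_ , (((refl , refl) , refl) , ((refl , refl) , rσ′σ″)) , ((cστ , tt) , (tt , dσ″τ′)))
             , (((refl , refl) , sττ′) , ((refl , refl) , refl)) })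

  forwardSim⇔forwardLHS⊆forwardRHS : ForwardSim c d R S ⇔ (forwardLHS ⊆ᵣ forwardRHS)
  forwardSim⇔forwardLHS⊆forwardRHS = mk⇔ sim⇒⊆ ⊆⇒sim
    where
    open Equivalence
    sim⇒⊆ : ForwardSim c d R S → forwardLHS ⊆ᵣ forwardRHS
    sim⇒⊆ sim (σ , σ′) (τ , τ′) p with to forwardLHS-pointwise p
    ... | r , cστ , refl = from forwardRHS-pointwise (r , cστ , refl , sim σ σ′ τ r cστ)
    ⊆⇒sim : forwardLHS ⊆ᵣ forwardRHS → ForwardSim c d R S
    ⊆⇒sim incl σ σ′ τ r cστ with to forwardRHS-pointwise
                                   (incl (σ , σ′) (τ , τ) (from forwardLHS-pointwise (r , cστ , refl)))
    ... | _ , _ , _ , step = step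

  backwardSim⇔backwardLHS⊆backwardRHS : BackwardSim c d R S ⇔ (backwardLHS ⊆ᵣ backwardRHS)
  backwardSim⇔backwardLHS⊆backwardRHS = mk⇔ sim⇒⊆ ⊆⇒sim
    where
    open Equivalence
    sim⇒⊆ : BackwardSim c d R S → backwardLHS ⊆ᵣ backwardRHS
    sim⇒⊆ sim (σ , σ′) (τ , τ′) p with to backwardLHS-pointwise p
    ... | refl , cστ , sττ′ = from backwardRHS-pointwise (refl , cστ , sττ′ , sim σ τ τ′ cστ sττ′)
    ⊆⇒sim : backwardLHS ⊆ᵣ backwardRHS → BackwardSim c d R S
    ⊆⇒sim incl σ τ τ′ cστ sττ′ with to backwardRHS-pointwise
                                     (incl (σ , σ) (τ , τ′) (from backwardLHS-pointwise (refl , cστ , sττ′)))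
    ... | _ , _ , _ , step = step

lemma7p10 : {Σ : Set} (c d R S : Rel Σ)
    → (ForwardSim c d R S ⇔ (dot R ⨾ ⟨ c ∣ hav ⟩ ⨾ dot idᵣ ⊆ᵣ ⇙ (⟨ dot R ∥ dot idᵣ ⟩ ⨾ ⟨ c ∣ hav ∣ d ⟩ ⨾ ⟨ dot idᵣ ∥ dot S ⟩)))
    × (BackwardSim c d R S ⇔ (dot idᵣ ⨾ ⟨ c ∣ hav ⟩ ⨾ dot S ⊆ᵣ ⇙ (⟨ dot idᵣ ∥ dot R ⟩ ⨾ ⟨ c ∣ hav ∣ d ⟩ ⨾ ⟨ dot S ∥ dot idᵣ ⟩)))
lemma7p10 c d R S =
  forwardSim⇔forwardLHS⊆forwardRHS c d R S , backwardSim⇔backwardLHS⊆backwardRHS c d R S
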